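{- For $n\ge 1$ let $\psi_n(\mathbf{x},\mathbf{a},\mathbf{b})$ with $\mathbf{x}=(x_1,\dots,x_n)$, $\mathbf{a}=(a_1,\dots,a_n)$, $\mathbf{b}=(b_1,\dots,b_n)$ be the CNF consisting of the clauses $\neg a_i\vee\neg x_i\vee x_{i+1}$, $\neg a_i\vee x_i\vee\neg x_{i+1}$, $\neg b_i\vee\neg x_i\vee x_{i+1}$, $\neg b_i\vee x_i\vee\neg x_{i+1}$ for $i=1,\dots,n-1$, and $\neg a_n\vee\neg x_1\vee\neg x_n$, $\neg a_n\vee x_1\vee x_n$, $\neg b_n\vee\neg x_1\vee\neg x_n$, $\neg b_n\vee x_1\vee x_n$. There is a PC encoding of the function represented by $\psi_n$ of size linear in the number of variables.
   Context: Size is the number of clauses. A partial assignment is a set of literals with no complementary pair, identified with their conjunction; $\vdash_1$ denotes derivability by repeated unit resolution (deriving $C\setminus\{l\}$ from $C\ni l$ and $\neg l$); $\bot$ is the empty clause. A CNF $\varphi(\mathbf{z})$ is PC if for every partial assignment $\alpha$ of $\mathbf{z}$ and literal $l$ on $\mathbf{z}$ with $\varphi\wedge\alpha\models l$, $\varphi\wedge\alpha\vdash_1 l$ or $\varphi\wedge\alpha\vdash_1\bot$. A CNF $\psi(\mathbf{x},\mathbf{y})$ is an encoding of $f(\mathbf{x})$ if $f(\mathbf{a})=\exists\mathbf{b}\,\psi(\mathbf{a},\mathbf{b})$ for all $\mathbf{a}$; a PC encoding is an encoding that is PC on all its variables. -}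

module Defs where

open import Data.Nat using (ℕ; zero; suc; _+_; _*_; _∸_; _<_; _≤_)
open import Data.Nat.Properties using () renaming (_≟_ to _≟ℕ_)
open import Data.Bool using (Bool; true; false; not)
open import Data.List using (List; []; _∷_; [_]; filter; concatMap; upTo; length; _++_)
open import Data.List.Relation.Unary.All using (All)
open import Data.List.Relation.Unary.Any using (Any)
open import Data.List.Membership.Propositional using (_∈_)
open import Data.Product using (Σ; _×_; _,_)
open import Data.Sum using (_⊎_)
open import Data.Empty using (⊥)
open import Relation.Nullary using (Dec; yes; no; ¬_)
open import Relation.Nullary.Decidable using (¬?)
open import Relation.Binary.PropositionalEquality using (_≡_; refl; cong)
open import Function.Bundles using (_⇔_)

data Lit : Set where
  pos : ℕ → Lit
  neg : ℕ → Lit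

var : Lit → ℕ
var (pos v) = v
var (neg v) = v

negate : Lit → Lit
negate (pos v) = neg v
negate (neg v) = pos v

_≟L_ : (l m : Lit) → Dec (l ≡ m)
pos v ≟L pos w with v ≟ℕ w
... | yes refl = yes refl
... | no ne = no λ { refl → ne refl }
pos v ≟L neg w = no λ ()
neg v ≟L pos w = no λ ()
neg v ≟L neg w with v ≟ℕ w
... | yes refl = yes refl
... | no ne = no λ { refl → ne refl }

Clause : Set
Clause = List Lit

-- A CNF is a list of clauses; its size is its number of clauses (length).
CNF : Set
CNF = List Clause

Assignment : Set
Assignment = ℕ → Bool

evalLit : Assignment → Lit → Bool
evalLit σ (pos v) = σ v
evalLit σ (neg v) = not (σ v)

SatClause : Assignment → Clause → Set
SatClause σ C = Any (λ l → evalLit σ l ≡ true) C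

Sat : Assignment → CNF → Set
Sat σ φ = All (SatClause σ) φ

Occurs : ℕ → CNF → Set
Occurs v φ = Any (Any (λ l → var l ≡ v)) φ

-- Partial assignments: sets (lists) of literals with no complementary pair.

Consistent : List Lit → Set
Consistent α = ∀ l → l ∈ α → negate l ∈ α → ⊥

Entails : CNF → List Lit → Lit → Set
Entails φ α l = ∀ (σ : Assignment) → Sat σ φ → All (λ m → evalLit σ m ≡ true) α →
                evalLit σ l ≡ true

remove : Lit → Clause → Clause
remove l C = filter (λ m → ¬? (m ≟L l)) C

-- A clause D represents the unit clause {l} (as a set)
IsUnit : Lit → Clause → Set
IsUnit l D = Σ Lit (λ m → m ∈ D) × All (λ m → m ≡ l) D

data URDerives (φ : CNF) (α : List Lit) : Clause → Set where
  axiom  : ∀ {C} → C ∈ φ → URDerives φ α C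
  assume : ∀ {l} → l ∈ α → URDerives φ α [ l ]
  resolve : ∀ {C D l} → URDerives φ α C → l ∈ C →
            URDerives φ α D → IsUnit (negate l) D →
            URDerives φ α (remove l C)

DerivesLit : CNF → List Lit → Lit → Set
DerivesLit φ α l = Σ Clause (λ D → URDerives φ α D × IsUnit l D)

DerivesBot : CNF → List Lit → Set
DerivesBot φ α = URDerives φ α []

PC : CNF → Set
PC φ = ∀ (α : List Lit) → Consistent α → All (λ m → Occurs (var m) φ) α →
       ∀ (l : Lit) → Occurs (var l) φ →
       Entails φ α l → DerivesLit φ α l ⊎ DerivesBot φ α

IsEncoding : ℕ → CNF → CNF → Set
IsEncoding k f ψ = ∀ (σ : Assignment) →
  Sat σ f ⇔ Σ Assignment (λ τ → (∀ v → v < k → τ v ≡ σ v) × Sat τ ψ)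

-- The CNF ψ_n.  Variables (0-indexed): x_{i+1} ↦ i, a_{i+1} ↦ n + i,
-- b_{i+1} ↦ 2n + i, for i = 0 … n-1.

xv av bv : ℕ → ℕ → ℕ
xv n i = i
av n i = n + i
bv n i = n + n + i

-- clauses for index i (1-indexed i+1), i+1 = 1 … n-1
chainClauses : ℕ → ℕ → List Clause
chainClauses n i =
  (neg (av n i) ∷ neg (xv n i) ∷ pos (xv n (suc i)) ∷ []) ∷
  (neg (av n i) ∷ pos (xv n i) ∷ neg (xv n (suc i)) ∷ []) ∷
  (neg (bv n i) ∷ neg (xv n i) ∷ pos (xv n (suc i)) ∷ []) ∷
  (neg (bv n i) ∷ pos (xv n i) ∷ neg (xv n (suc i)) ∷ []) ∷ []

lastClauses : ℕ → List Clause
lastClauses n =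
  (neg (av n (n ∸ 1)) ∷ neg (xv n 0) ∷ neg (xv n (n ∸ 1)) ∷ []) ∷
  (neg (av n (n ∸ 1)) ∷ pos (xv n 0) ∷ pos (xv n (n ∸ 1)) ∷ []) ∷
  (neg (bv n (n ∸ 1)) ∷ neg (xv n 0) ∷ neg (xv n (n ∸ 1)) ∷ []) ∷
  (neg (bv n (n ∸ 1)) ∷ pos (xv n 0) ∷ pos (xv n (n ∸ 1)) ∷ []) ∷ []

psi : ℕ → CNF
psi n = concatMap (chainClauses n) (upTo (n ∸ 1)) ++ lastClauses n

-- Add variables c₀ … cₘ with the clauses c₀ ∨ … ∨ cₘ, cᵢ → ¬aᵢ and cᵢ → ¬bᵢ
-- (6n + 1 clauses in all).  Every model of ψₙ switches some edge off, since
-- going once around the cycle flips x, so this is an encoding of ψₙ.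
--
-- Propagation completeness reduces to: every consistent unit-closed α,
-- extended by one fresh literal t, has a model.  The clause c₀ ∨ … ∨ cₘ is
-- either satisfied by α or keeps two free literals, and t can interfere with
-- only one of them; this switches off an edge e₀.  Cutting the cycle at e₀,
-- the x-values are propagated around it starting behind e₀.  Unit closure
-- makes every active edge respect α, except possibly one edge switched on by
-- t, whose far end may already be fixed; flipping all unassigned x-variables
-- at once repairs that edge, and the same flip realises t when t is an
-- x-literal.

module Submission where

open import Defs
open import Data.Nat using (ℕ; zero; suc; _+_; _*_; _∸_; _<_; _≤_; s≤s; z≤n; _<?_; _≟_)
open import Data.Nat.Properties
  using (≤-refl; ≤-trans; <-≤-trans; m≤n⇒m≤1+n; <⇒≤; <-irrefl; ≤∧≢⇒<; m≤n⇒m<n∨m≡n; m<1+n⇒m<n∨m≡n;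
         anyUpTo?;
         m≤m+n; m+n∸m≡n; module ≤-Reasoning; +-assoc; +-comm; +-identityʳ; +-monoʳ-<; +-cancelˡ-≡)
open import Data.Nat.Induction using (<-wellFounded)
open import Data.Nat.Tactic.RingSolver using (solve-∀)
open import Induction.WellFounded using (Acc; acc)
open import Data.Bool using (Bool; true; false; not; _∧_; _∨_; _xor_)
open import Data.Bool.Properties
  using (xor-assoc; xor-comm; xor-same; xor-identityʳ; true-xor; ∧-zeroʳ; ∧-identityʳ; ∨-zeroʳ;
         ∨-conicalˡ; ∨-conicalʳ; not-involutive; not-injective; not-¬; ¬-not) renaming (_≟_ to _≟ᴮ_)
open import Data.Maybe using (Maybe; just; nothing; fromMaybe; is-nothing; _<∣>_)
open import Data.Maybe.Properties using (just-injective)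
open import Data.List using (List; []; _∷_; [_]; _++_; filter; concat; concatMap; map; upTo; length)
open import Data.List.Properties using (filter-all; filter-none; length-++; length-upTo)
open import Data.List.Relation.Unary.All as All using (All; []; _∷_)
open import Data.List.Relation.Unary.All.Properties using (¬All⇒Any¬; ++⁺; ++⁻ˡ; concat⁺; map⁺; applyUpTo⁺₁)
open import Data.List.Relation.Unary.Any using (Any; here; there; any?)
open import Data.List.Membership.Propositional using (_∈_; _∉_; find; lose)
open import Data.List.Membership.Propositional.Properties
  using (∈-filter⁺; ∈-filter⁻; ∈-concat⁺′; ∈-++⁺ˡ; ∈-++⁺ʳ; ∈-concatMap⁺; ∈-upTo⁺; ∈-upTo⁻;
         ∈-map⁺; ∈-map⁻)
open import Data.List.Membership.DecPropositional _≟L_ using (_∈?_)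
open import Data.Product using (Σ; _×_; _,_; proj₁; proj₂)
open import Data.Sum using (_⊎_; inj₁; inj₂)
open import Function using (_∘_; id)
open import Function.Bundles using (mk⇔)
open import Data.Empty using (⊥; ⊥-elim)
open import Relation.Nullary using (Dec; yes; no; ¬_; contradiction)
open import Relation.Nullary.Decidable using (¬?; _×-dec_; _⊎-dec_; does; dec-true; dec-false)
open import Relation.Binary.PropositionalEquality
  using (_≡_; _≢_; refl; sym; trans; cong; cong₂; subst; subst₂; module ≡-Reasoning)

negate-involutive : ∀ l → negate (negate l) ≡ l
negate-involutive (pos v) = refl
negate-involutive (neg v) = refl

negate-irreflexive : ∀ l → negate l ≢ l
negate-irreflexive (pos v) ()
negate-irreflexive (neg v) ()

var-negate : ∀ l → var (negate l) ≡ var l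
var-negate (pos v) = refl
var-negate (neg v) = refl

negate-injective : ∀ {l l′} → negate l ≡ negate l′ → l ≡ l′
negate-injective {l} {l′} eq = trans (sym (negate-involutive l)) (trans (cong negate eq) (negate-involutive l′))

lit : ℕ → Bool → Lit
lit v true  = pos v
lit v false = neg v

sign : Lit → Bool
sign (pos _) = true
sign (neg _) = false

lit-var : ∀ v b → var (lit v b) ≡ v
lit-var v true  = refl
lit-var v false = refl

lit-sign : ∀ v b → sign (lit v b) ≡ b
lit-sign v true  = refl
lit-sign v false = refl

lit-var-sign : ∀ l → lit (var l) (sign l) ≡ l
lit-var-sign (pos v) = refl
lit-var-sign (neg v) = refl

litValue : Lit → Bool → Bool
litValue (pos _) b = b
litValue (neg _) b = not b

lit-true : ∀ l {b} → litValue l b ≡ true → lit (var l) b ≡ l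
lit-true (pos v) refl = refl
lit-true (neg v) {false} _ = refl

lit-false : ∀ l {b} → litValue l b ≡ false → lit (var l) b ≡ negate l
lit-false (pos v) refl = refl
lit-false (neg v) {true} _ = refl

evalLit-negate : ∀ σ l → evalLit σ (negate l) ≡ not (evalLit σ l)
evalLit-negate σ (pos v) = refl
evalLit-negate σ (neg v) = sym (not-involutive (σ v))

evalLit-contradiction : ∀ σ l → evalLit σ l ≡ true → evalLit σ (negate l) ≡ true → ⊥
evalLit-contradiction σ l l-true ¬l-true with trans (sym ¬l-true) (trans (evalLit-negate σ l) (cong not l-true))
... | ()

evalLit-sign : ∀ σ l → σ (var l) ≡ sign l → evalLit σ l ≡ true
evalLit-sign σ (pos v) eq = eq
evalLit-sign σ (neg v) eq = cong not eq

unsat-clause : ∀ {σ C} → SatClause σ C → All (λ l → evalLit σ l ≡ false) C → ⊥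
unsat-clause (here t)  (f ∷ _) with trans (sym t) f
... | ()
unsat-clause (there s) (_ ∷ fs) = unsat-clause s fs

-- Unit propagation

Forces : List Lit → Clause → Lit → Set
Forces α C m = All (λ l → l ≡ m ⊎ negate l ∈ α) C

forces? : ∀ α C m → Dec (Forces α C m)
forces? α C m = All.all? (λ l → (l ≟L m) ⊎-dec (negate l ∈? α)) C

forces-or-free : ∀ α C m → Forces α C m ⊎ Σ Lit λ l → l ∈ C × l ≢ m × negate l ∉ α
forces-or-free α C m with forces? α C m
... | yes f = inj₁ f
... | no ¬f with find (¬All⇒Any¬ (λ l → (l ≟L m) ⊎-dec (negate l ∈? α)) C ¬f)
...   | l , l∈C , ¬forced = inj₂ (l , l∈C , (λ e → ¬forced (inj₁ e)) , (λ q → ¬forced (inj₂ q)))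

forces-other : ∀ {α C m l} → Forces α C m → l ∈ C → l ≢ m → negate l ∈ α
forces-other f l∈C l≢m with All.lookup f l∈C
... | inj₁ l≡m = contradiction l≡m l≢m
... | inj₂ q = q

UnitClosed : CNF → List Lit → Set
UnitClosed φ α = ∀ {C m} → C ∈ φ → m ∈ C → Forces α C m → m ∈ α

UnitClosureComplete : CNF → Set
UnitClosureComplete φ =
  ∀ α → Consistent α → UnitClosed φ α → ∀ l → l ∉ α → ¬ Entails φ α l

PendingUnit : CNF → List Lit → Set
PendingUnit φ α = Any (λ C → Any (λ m → Forces α C m × m ∉ α) C) φ

pendingUnit? : ∀ φ α → Dec (PendingUnit φ α)
pendingUnit? φ α = any? (λ C → any? (λ m → forces? α C m ×-dec ¬? (m ∈? α)) C) φ

unitClosed-or-pending : ∀ φ α → UnitClosed φ α ⊎ PendingUnit φ α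
unitClosed-or-pending φ α with pendingUnit? φ α
... | yes p = inj₂ p
... | no ¬p = inj₁ closed
  where
  closed : UnitClosed φ α
  closed {C} {m} C∈φ m∈C f with m ∈? α
  ... | yes m∈α = m∈α
  ... | no m∉α = contradiction (lose C∈φ (lose m∈C (f , m∉α))) ¬p

removeAll : List Lit → Clause → Clause
removeAll []       C = C
removeAll (l ∷ ls) C = removeAll ls (remove l C)

∈-remove⁻ : ∀ {x l C} → x ∈ remove l C → x ∈ C × x ≢ l
∈-remove⁻ = ∈-filter⁻ (λ y → ¬? (y ≟L _))

∈-remove⁺ : ∀ {x l C} → x ∈ C → x ≢ l → x ∈ remove l C
∈-remove⁺ = ∈-filter⁺ (λ y → ¬? (y ≟L _))

∈-removeAll⁻ : ∀ {x} ls C → x ∈ removeAll ls C → x ∈ C × x ∉ ls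
∈-removeAll⁻ []       C x∈ = x∈ , λ ()
∈-removeAll⁻ (l ∷ ls) C x∈ with ∈-removeAll⁻ ls (remove l C) x∈
... | x∈R , x∉ls with ∈-remove⁻ x∈R
...   | x∈C , x≢l = x∈C , λ { (here x≡l) → x≢l x≡l ; (there x∈ls) → x∉ls x∈ls }

∈-removeAll⁺ : ∀ {x} ls C → x ∈ C → x ∉ ls → x ∈ removeAll ls C
∈-removeAll⁺ []       C x∈C x∉ls = x∈C
∈-removeAll⁺ (l ∷ ls) C x∈C x∉ls =
  ∈-removeAll⁺ ls (remove l C) (∈-remove⁺ x∈C (x∉ls ∘ here)) (x∉ls ∘ there)

remove-absent : ∀ l C → l ∉ C → remove l C ≡ C
remove-absent l C l∉C =
  filter-all (λ y → ¬? (y ≟L l)) (All.tabulate λ {x} x∈C x≡l → l∉C (subst (_∈ C) x≡l x∈C))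

remove-unit : ∀ m D → All (_≡ m) D → remove m D ≡ []
remove-unit m D all≡ = filter-none (λ y → ¬? (y ≟L m)) (All.map (λ x≡m x≢m → x≢m x≡m) all≡)

isUnit-singleton : ∀ l → IsUnit l [ l ]
isUnit-singleton l = (l , here refl) , (refl ∷ [])

resolveAll : ∀ {φ α C} → URDerives φ α C → (ls : List Lit) → All (λ l → negate l ∈ α) ls →
             URDerives φ α (removeAll ls C)
resolveAll d []       []       = d
resolveAll {C = C} d (l ∷ ls) (q ∷ qs) with l ∈? C
... | yes l∈C = resolveAll (resolve d l∈C (assume q) (isUnit-singleton (negate l))) ls qs
... | no l∉C  = resolveAll (subst (URDerives _ _) (sym (remove-absent l C l∉C)) d) ls qs

derive-forced : ∀ {φ α C m} → C ∈ φ → m ∈ C → Forces α C m → DerivesLit φ α m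
derive-forced {φ} {α} {C} {m} C∈φ m∈C f =
  removeAll others C , resolveAll (axiom C∈φ) others falsified , (m , m∈R) , All.tabulate only-m
  where
  others = filter (λ l → ¬? (l ≟L m)) C
  ∈-others⁻ : ∀ {l} → l ∈ others → l ∈ C × l ≢ m
  ∈-others⁻ = ∈-filter⁻ (λ l → ¬? (l ≟L m))
  falsified : All (λ l → negate l ∈ α) others
  falsified = All.tabulate λ l∈ → let l∈C , l≢m = ∈-others⁻ l∈ in forces-other f l∈C l≢m
  m∈R : m ∈ removeAll others C
  m∈R = ∈-removeAll⁺ others C m∈C λ m∈ → proj₂ (∈-others⁻ m∈) refl
  only-m : ∀ {x} → x ∈ removeAll others C → x ≡ m
  only-m {x} x∈ with ∈-removeAll⁻ others C x∈ | x ≟L m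
  ... | _ | yes x≡m = x≡m
  ... | x∈C , x∉others | no x≢m = ⊥-elim (x∉others (∈-filter⁺ (λ l → ¬? (l ≟L m)) x∈C x≢m))

isUnit-resp : ∀ {l l′ D} → l ≡ l′ → IsUnit l D → IsUnit l′ D
isUnit-resp refl u = u

unit-member : ∀ {m D} → IsUnit m D → m ∈ D
unit-member {D = D} ((m′ , m′∈D) , all≡) = subst (_∈ D) (All.lookup all≡ m′∈D) m′∈D

refute-unit : ∀ {φ α D m} → URDerives φ α D → IsUnit m D → negate m ∈ α → DerivesBot φ α
refute-unit {D = D} {m} d u q =
  subst (URDerives _ _) (remove-unit m D (proj₂ u))
    (resolve d (unit-member u) (assume q) (isUnit-singleton (negate m)))

discharge : ∀ {φ α D m C} → URDerives φ α D → IsUnit m D → URDerives φ (m ∷ α) C →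
            URDerives φ α C ⊎ C ≡ [ m ]
discharge dD u (axiom C∈φ)          = inj₁ (axiom C∈φ)
discharge dD u (assume (here refl)) = inj₂ refl
discharge dD u (assume (there l∈α)) = inj₁ (assume l∈α)
discharge {φ} {α} {D} {m} dD u (resolve {l = l} d₁ l∈C d₂ u₂)
  with discharge dD u d₁ | discharge dD u d₂
... | inj₁ d₁′ | inj₁ d₂′ = inj₁ (resolve d₁′ l∈C d₂′ u₂)
... | inj₁ d₁′ | inj₂ refl = inj₁ (resolve d₁′ l∈C dD (isUnit-resp (All.lookup (proj₂ u₂) (here refl)) u))
... | inj₂ refl | r₂ with l∈C
...   | here refl with r₂
...     | inj₂ refl = ⊥-elim (negate-irreflexive m (sym (All.lookup (proj₂ u₂) (here refl))))
...     | inj₁ d₂′ = inj₁ (subst (URDerives φ α) remove-m (resolve dD (unit-member u) d₂′ u₂))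
  where
  remove-m : remove m D ≡ remove m [ m ]
  remove-m = trans (remove-unit m D (proj₂ u)) (sym (remove-unit m [ m ] (refl ∷ [])))

discharge-lit : ∀ {φ α D m l} → URDerives φ α D → IsUnit m D → DerivesLit φ (m ∷ α) l → DerivesLit φ α l
discharge-lit dD u (C , d , uC) with discharge dD u d
... | inj₁ d′ = C , d′ , uC
... | inj₂ refl = _ , dD , isUnit-resp (All.lookup (proj₂ uC) (here refl)) u

discharge-bot : ∀ {φ α D m} → URDerives φ α D → IsUnit m D → DerivesBot φ (m ∷ α) → DerivesBot φ α
discharge-bot dD u d with discharge dD u d
... | inj₁ d′ = d′
... | inj₂ ()

-- From closure completeness to propagation completeness

module _ {A : Set} {P Q : A → Set} (P? : ∀ x → Dec (P x)) (Q? : ∀ x → Dec (Q x)) (P⇒Q : ∀ {x} → P x → Q x) where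

  length-filter-mono : ∀ xs → length (filter P? xs) ≤ length (filter Q? xs)
  length-filter-mono []       = z≤n
  length-filter-mono (x ∷ xs) with P? x | Q? x
  ... | yes _  | yes _  = s≤s (length-filter-mono xs)
  ... | yes px | no ¬qx = contradiction (P⇒Q px) ¬qx
  ... | no _   | yes _  = m≤n⇒m≤1+n (length-filter-mono xs)
  ... | no _   | no _   = length-filter-mono xs

  length-filter-strict : ∀ {x} xs → x ∈ xs → Q x → ¬ P x → length (filter P? xs) < length (filter Q? xs)
  length-filter-strict (y ∷ xs) (here refl) qx ¬px with P? y | Q? y
  ... | yes px | _      = contradiction px ¬px
  ... | no _   | yes _  = s≤s (length-filter-mono xs)
  ... | no _   | no ¬qx = contradiction qx ¬qx
  length-filter-strict (y ∷ xs) (there x∈) qx ¬px with P? y | Q? y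
  ... | yes _  | yes _  = s≤s (length-filter-strict xs x∈ qx ¬px)
  ... | yes py | no ¬qy = contradiction (P⇒Q py) ¬qy
  ... | no _   | yes _  = m≤n⇒m≤1+n (length-filter-strict xs x∈ qx ¬px)
  ... | no _   | no _   = length-filter-strict xs x∈ qx ¬px

Unassigned : List Lit → ℕ → Set
Unassigned α v = pos v ∉ α × neg v ∉ α

unassigned? : ∀ α v → Dec (Unassigned α v)
unassigned? α v = ¬? (pos v ∈? α) ×-dec ¬? (neg v ∈? α)

unassigned-var : ∀ {α} l → l ∉ α → negate l ∉ α → Unassigned α (var l)
unassigned-var (pos v) l∉α ¬l∉α = l∉α , ¬l∉α
unassigned-var (neg v) l∉α ¬l∉α = ¬l∉α , l∉α

assigned-var : ∀ {α} l → ¬ Unassigned (l ∷ α) (var l)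
assigned-var (pos v) (p∉ , _) = p∉ (here refl)
assigned-var (neg v) (_ , n∉) = n∉ (here refl)

unassignedOccurrences : CNF → List Lit → ℕ
unassignedOccurrences φ α = length (filter (λ l → unassigned? α (var l)) (concat φ))

unassignedOccurrences-∷ : ∀ φ α {C m} → C ∈ φ → m ∈ C → m ∉ α → negate m ∉ α →
  unassignedOccurrences φ (m ∷ α) < unassignedOccurrences φ α
unassignedOccurrences-∷ φ α {m = m} C∈φ m∈C m∉α ¬m∉α =
  length-filter-strict (λ l → unassigned? (m ∷ α) (var l)) (λ l → unassigned? α (var l))
    (λ (p∉ , n∉) → p∉ ∘ there , n∉ ∘ there)
    (concat φ) (∈-concat⁺′ m∈C C∈φ) (unassigned-var m m∉α ¬m∉α) (assigned-var m)

consistent-∷ : ∀ {α m} → Consistent α → negate m ∉ α → Consistent (m ∷ α)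
consistent-∷ cons ¬m∉α l (here refl) (here ¬l≡l)  = negate-irreflexive l ¬l≡l
consistent-∷ cons ¬m∉α l (here refl) (there ¬l∈α) = ¬m∉α ¬l∈α
consistent-∷ {α} cons ¬m∉α l (there l∈α) (here ¬l≡m) =
  ¬m∉α (subst (_∈ α) (trans (sym (negate-involutive l)) (cong negate ¬l≡m)) l∈α)
consistent-∷ cons ¬m∉α l (there l∈α) (there ¬l∈α) = cons l l∈α ¬l∈α

pc-from-closure : ∀ {φ} → UnitClosureComplete φ → PC φ
pc-from-closure {φ} complete α₀ cons₀ _ l _ ent₀ = go α₀ (<-wellFounded _) cons₀ ent₀
  where
  go : ∀ α → Acc _<_ (unassignedOccurrences φ α) → Consistent α → Entails φ α l →
       DerivesLit φ α l ⊎ DerivesBot φ α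
  go α (acc rec) cons ent with unitClosed-or-pending φ α
  ... | inj₁ closed with l ∈? α
  ...   | yes l∈α = inj₁ ([ l ] , assume l∈α , isUnit-singleton l)
  ...   | no l∉α  = ⊥-elim (complete α cons closed l l∉α ent)
  go α (acc rec) cons ent | inj₂ pending with find pending
  ... | C , C∈φ , p with find p
  ...   | m , m∈C , forced , m∉α with derive-forced C∈φ m∈C forced | negate m ∈? α
  ...     | D , dD , unit | yes ¬m∈α = inj₂ (refute-unit dD unit ¬m∈α)
  ...     | D , dD , unit | no ¬m∉α
    with go (m ∷ α) (rec (unassignedOccurrences-∷ φ α C∈φ m∈C m∉α ¬m∉α)) (consistent-∷ cons ¬m∉α)
            (λ σ σ⊨φ σ⊨mα → ent σ σ⊨φ (All.tail σ⊨mα))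
  ... | inj₁ r = inj₁ (discharge-lit dD unit r)
  ... | inj₂ r = inj₂ (discharge-bot dD unit r)

-- Valuations of partial assignments

is-nothing-true : ∀ {A : Set} {x : Maybe A} → is-nothing x ≡ true → x ≡ nothing
is-nothing-true {x = nothing} _ = refl

is-nothing-false : ∀ {A : Set} {x : Maybe A} → is-nothing x ≡ false → Σ A λ a → x ≡ just a
is-nothing-false {x = just a} _ = a , refl

valuation : List Lit → ℕ → Maybe Bool
valuation α v with pos v ∈? α | neg v ∈? α
... | yes _ | _     = just true
... | no _  | yes _ = just false
... | no _  | no _  = nothing

module _ {α : List Lit} (cons : Consistent α) where

  valuation-∈ : ∀ {l} → l ∈ α → valuation α (var l) ≡ just (sign l)
  valuation-∈ {pos v} p∈ with pos v ∈? α
  ... | yes _  = refl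
  ... | no p∉ = contradiction p∈ p∉
  valuation-∈ {neg v} n∈ with pos v ∈? α | neg v ∈? α
  ... | yes p∈ | _     = ⊥-elim (cons (pos v) p∈ n∈)
  ... | no _   | yes _ = refl
  ... | no _   | no n∉ = contradiction n∈ n∉

valuation-lit : ∀ {α} → Consistent α → ∀ {v} b → lit v b ∈ α → valuation α v ≡ just b
valuation-lit cons true  p∈ = valuation-∈ cons p∈
valuation-lit cons false n∈ = valuation-∈ cons n∈

valuation-just : ∀ {α v b} → valuation α v ≡ just b → lit v b ∈ α
valuation-just {α} {v} eq with pos v ∈? α | neg v ∈? α
valuation-just refl | yes p∈ | _      = p∈
valuation-just refl | no _   | yes n∈ = n∈
valuation-just ()   | no _   | no _

valuation-unassigned : ∀ {α v} → Unassigned α v → valuation α v ≡ nothing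
valuation-unassigned {α} {v} (p∉ , n∉) with pos v ∈? α | neg v ∈? α
... | yes p∈ | _      = contradiction p∈ p∉
... | no _   | yes n∈ = contradiction n∈ n∉
... | no _   | no _   = refl

Holds : List Lit → Maybe Lit → Lit → Set
Holds α t l = l ∈ α ⊎ t ≡ just l

Fresh : List Lit → Maybe Lit → Set
Fresh α t = ∀ l → t ≡ just l → Unassigned α (var l)

assigned-∈ : ∀ {α l} → l ∈ α → ¬ Unassigned α (var l)
assigned-∈ {l = pos v} p∈ (p∉ , _) = p∉ p∈
assigned-∈ {l = neg v} n∈ (_ , n∉) = n∉ n∈

module _ {φ : CNF} {α : List Lit} (closed : UnitClosed φ α) where

  satisfied-or-two-free : ∀ {C m₀} → C ∈ φ → m₀ ∈ C →
    Any (_∈ α) C ⊎ Σ Lit λ l → Σ Lit λ l′ → l ∈ C × l′ ∈ C × l ≢ l′ × negate l ∉ α × negate l′ ∉ α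
  satisfied-or-two-free {C} {m₀} C∈φ m₀∈C with forces-or-free α C m₀
  ... | inj₁ f = inj₁ (lose m₀∈C (closed C∈φ m₀∈C f))
  ... | inj₂ (l , l∈C , _ , ¬l∉α) with forces-or-free α C l
  ...   | inj₁ f = inj₁ (lose l∈C (closed C∈φ l∈C f))
  ...   | inj₂ (l′ , l′∈C , l′≢l , ¬l′∉α) =
    inj₂ (l , l′ , l∈C , l′∈C , (λ e → l′≢l (sym e)) , ¬l∉α , ¬l′∉α)

  -- Either C is satisfied by α, or it has two free literals and t falsifies at most one of them.
  extension-refutes-no-clause : Consistent α → ∀ {t} → Fresh α t → ∀ {C m₀} → C ∈ φ → m₀ ∈ C →
    ¬ All (λ l → Holds α t (negate l)) C
  extension-refutes-no-clause cons {t} fresh C∈φ m₀∈C refuted with satisfied-or-two-free C∈φ m₀∈C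
  ... | inj₁ sat with find sat
  ...   | l , l∈C , l∈α with All.lookup refuted l∈C
  ...     | inj₁ ¬l∈α = cons l l∈α ¬l∈α
  ...     | inj₂ t≡¬l = assigned-∈ l∈α (subst (Unassigned α) (var-negate l) (fresh (negate l) t≡¬l))
  extension-refutes-no-clause cons {t} fresh C∈φ m₀∈C refuted
    | inj₂ (l , l′ , l∈C , l′∈C , l≢l′ , ¬l∉α , ¬l′∉α)
    with All.lookup refuted l∈C | All.lookup refuted l′∈C
  ... | inj₁ ¬l∈α | _ = ¬l∉α ¬l∈α
  ... | _ | inj₁ ¬l′∈α = ¬l′∉α ¬l′∈α
  ... | inj₂ t≡¬l | inj₂ t≡¬l′ = l≢l′ (negate-injective (just-injective (trans (sym t≡¬l) t≡¬l′)))

singleValuation : Maybe Lit → ℕ → Maybe Bool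
singleValuation nothing  v = nothing
singleValuation (just l) v with var l ≟ v
... | yes _ = just (sign l)
... | no _  = nothing

singleValuation-just : ∀ t {v b} → singleValuation t v ≡ just b → t ≡ just (lit v b)
singleValuation-just (just l) {v} eq with var l ≟ v
singleValuation-just (just l) refl | yes refl = cong just (sym (lit-var-sign l))
singleValuation-just (just l) ()   | no _

singleValuation-self : ∀ l → singleValuation (just l) (var l) ≡ just (sign l)
singleValuation-self l with var l ≟ var l
... | yes _  = refl
... | no ¬eq = contradiction refl ¬eq

module _ {α : List Lit} (cons : Consistent α) {t : Maybe Lit} (fresh : Fresh α t) where

  extendedValuation : ℕ → Maybe Bool
  extendedValuation v = valuation α v <∣> singleValuation t v

  extendedValuation-holds : ∀ {v b} → extendedValuation v ≡ just b → Holds α t (lit v b)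
  extendedValuation-holds {v} eq with valuation α v in ea
  extendedValuation-holds refl | just b = inj₁ (valuation-just ea)
  ... | nothing = inj₂ (singleValuation-just t eq)

  holds-extendedValuation : ∀ {l} → Holds α t l → extendedValuation (var l) ≡ just (sign l)
  holds-extendedValuation (inj₁ l∈α) rewrite valuation-∈ cons l∈α = refl
  holds-extendedValuation {l} (inj₂ refl) rewrite valuation-unassigned (fresh l refl) = singleValuation-self l

-- The gadget g → (u ↔ l)

equivalence : ℕ → ℕ → Lit → List Clause
equivalence g u l = (neg g ∷ neg u ∷ l ∷ []) ∷ (neg g ∷ pos u ∷ negate l ∷ []) ∷ []

equivalence-sat : ∀ σ g u l → (σ g ≡ true → σ u ≡ evalLit σ l) → Sat σ (equivalence g u l)
equivalence-sat σ g u l h = sat₁ (σ g) (σ u) refl refl ∷ sat₂ (σ g) (σ u) refl refl ∷ []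
  where
  sat₁ : ∀ x y → σ g ≡ x → σ u ≡ y → SatClause σ (neg g ∷ neg u ∷ l ∷ [])
  sat₁ false _     eg _  = here (cong not eg)
  sat₁ true  false _  eu = there (here (cong not eu))
  sat₁ true  true  eg eu = there (there (here (trans (sym (h eg)) eu)))
  sat₂ : ∀ x y → σ g ≡ x → σ u ≡ y → SatClause σ (neg g ∷ pos u ∷ negate l ∷ [])
  sat₂ false _     eg _  = here (cong not eg)
  sat₂ true  true  _  eu = there (here eu)
  sat₂ true  false eg eu = there (there (here (trans (evalLit-negate σ l) (cong not (trans (sym (h eg)) eu)))))

equivalence-sound : ∀ σ {g u l} → Sat σ (equivalence g u l) → σ g ≡ true → σ u ≡ evalLit σ l
equivalence-sound σ {g} {u} {l} (s₁ ∷ s₂ ∷ []) eg = compare (σ u) (evalLit σ l) refl refl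
  where
  compare : ∀ x y → σ u ≡ x → evalLit σ l ≡ y → σ u ≡ evalLit σ l
  compare true  true  eu el = trans eu (sym el)
  compare false false eu el = trans eu (sym el)
  compare true  false eu el = ⊥-elim (unsat-clause s₁ (cong not eg ∷ cong not eu ∷ el ∷ []))
  compare false true  eu el =
    ⊥-elim (unsat-clause s₂ (cong not eg ∷ eu ∷ trans (evalLit-negate σ l) (cong not el) ∷ []))

bool-≡ : ∀ {x y} → (x ≡ false → y ≡ false) → (y ≡ false → x ≡ false) → x ≡ y
bool-≡ {true}  {true}  _ _ = refl
bool-≡ {false} {false} _ _ = refl
bool-≡ {true}  {false} _ y⇒x = y⇒x refl
bool-≡ {false} {true}  x⇒y _ = sym (x⇒y refl)

module _ {φ α} (cons : Consistent α) (closed : UnitClosed φ α)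
         {g u l} (gadget : ∀ {C} → C ∈ equivalence g u l → C ∈ φ) where

  private
    ∈₁ : (neg g ∷ neg u ∷ l ∷ []) ∈ φ
    ∈₁ = gadget (here refl)
    ∈₂ : (neg g ∷ pos u ∷ negate l ∷ []) ∈ φ
    ∈₂ = gadget (there (here refl))
    ¬¬l∈α : l ∈ α → negate (negate l) ∈ α
    ¬¬l∈α = subst (_∈ α) (sym (negate-involutive l))

  equivalence-consistent : ∀ {t} → Fresh α t → Holds α t (pos g) →
    ∀ {b b′} → valuation α u ≡ just b → valuation α (var l) ≡ just b′ → b ≡ litValue l b′
  equivalence-consistent fresh g-holds {b} {b′} eu el with b | litValue l b′ in e
  ... | true  | true  = refl
  ... | false | false = refl
  ... | true  | false = ⊥-elim (extension-refutes-no-clause closed cons fresh ∈₁ (here refl)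
        (g-holds ∷ inj₁ (valuation-just eu) ∷ inj₁ (subst (_∈ α) (lit-false l e) (valuation-just el)) ∷ []))
  ... | false | true  = ⊥-elim (extension-refutes-no-clause closed cons fresh ∈₂ (here refl)
        (g-holds ∷ inj₁ (valuation-just eu) ∷ inj₁ (¬¬l∈α (subst (_∈ α) (lit-true l e) (valuation-just el))) ∷ []))

  equivalence-balanced : pos g ∈ α → is-nothing (valuation α u) ≡ is-nothing (valuation α (var l))
  equivalence-balanced g∈α = bool-≡ forward backward
    where
    assigned : ∀ {l′} → l′ ∈ α → is-nothing (valuation α (var l′)) ≡ false
    assigned l′∈α = cong is-nothing (valuation-∈ cons l′∈α)
    forward : is-nothing (valuation α u) ≡ false → is-nothing (valuation α (var l)) ≡ false
    forward un with is-nothing-false un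
    ... | true  , eu = assigned (closed ∈₁ (there (there (here refl)))
                                 (inj₂ g∈α ∷ inj₂ (valuation-just eu) ∷ inj₁ refl ∷ []))
    ... | false , eu = trans (cong (λ v → is-nothing (valuation α v)) (sym (var-negate l)))
                         (assigned (closed ∈₂ (there (there (here refl)))
                                     (inj₂ g∈α ∷ inj₂ (valuation-just eu) ∷ inj₁ refl ∷ [])))
    backward : is-nothing (valuation α (var l)) ≡ false → is-nothing (valuation α u) ≡ false
    backward ln with is-nothing-false ln
    ... | b′ , el with litValue l b′ in e
    ...   | true  = assigned (closed ∈₂ (there (here refl))
                       (inj₂ g∈α ∷ inj₁ refl ∷ inj₂ (¬¬l∈α (subst (_∈ α) (lit-true l e) (valuation-just el))) ∷ []))
    ...   | false = assigned (closed ∈₁ (there (here refl))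
                       (inj₂ g∈α ∷ inj₁ refl ∷ inj₂ (subst (_∈ α) (lit-false l e) (valuation-just el)) ∷ []))

-- Xor constraints along a cycle

next : ℕ → ℕ → ℕ
next m e with e <? m
... | yes _ = suc e
... | no _  = 0

next-< : ∀ {m e} → e < m → next m e ≡ suc e
next-< {m} {e} e<m with e <? m
... | yes _   = refl
... | no e≮m = contradiction e<m e≮m

next-last : ∀ m → next m m ≡ 0
next-last m with m <? m
... | yes m<m = contradiction m<m (<-irrefl refl)
... | no _    = refl

next-≤ : ∀ {m e} → e ≤ m → next m e ≤ m
next-≤ {m} {e} e≤m with m≤n⇒m<n∨m≡n e≤m
... | inj₁ e<m rewrite next-< e<m = e<m
... | inj₂ refl rewrite next-last e = z≤n

xor-swap : ∀ a b c → (a xor b) xor c ≡ (a xor c) xor b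
xor-swap a b c = begin
  (a xor b) xor c ≡⟨ xor-assoc a b c ⟩
  a xor (b xor c) ≡⟨ cong (a xor_) (xor-comm b c) ⟩
  a xor (c xor b) ≡⟨ sym (xor-assoc a c b) ⟩
  (a xor c) xor b ∎
  where open ≡-Reasoning

xor-true : ∀ x → x xor true ≡ not x
xor-true x = trans (xor-comm x true) (true-xor x)

xor-cancelʳ : ∀ a b → (a xor b) xor b ≡ a
xor-cancelʳ a b = trans (xor-assoc a b b) (trans (cong (a xor_) (xor-same b)) (xor-identityʳ a))

xor-cancelˡ : ∀ a b → a xor (a xor b) ≡ b
xor-cancelˡ a b = trans (sym (xor-assoc a a b)) (cong (_xor b) (xor-same a))

-- Vertices 0 … m in cyclic order; edge e joins e to next m e and, when
-- active, demands that the values differ by w e along it.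
XorEdge : ℕ → (ℕ → Bool) → (ℕ → Bool) → ℕ → Set
XorEdge m w X e = X (next m e) ≡ X e xor w e

module XorCycle (m : ℕ) (w act : ℕ → Bool) (asg : ℕ → Maybe Bool) where

  Respects : (ℕ → Bool) → Set
  Respects X = ∀ v b → asg v ≡ just b → X v ≡ b

  Solves : (ℕ → Bool) → Set
  Solves X = Respects X × (∀ e → e ≤ m → act e ≡ true → XorEdge m w X e)

  ConsistentEdge : ℕ → Set
  ConsistentEdge e = ∀ b b′ → asg e ≡ just b → asg (next m e) ≡ just b′ → b′ ≡ b xor w e

  Balanced : ℕ → Set
  Balanced e = is-nothing (asg e) ≡ is-nothing (asg (next m e))

  AllBalanced AtMostOneUnbalanced : Set
  AllBalanced = ∀ e → e ≤ m → act e ≡ true → Balanced e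
  AtMostOneUnbalanced =
    ∀ e e′ → e ≤ m → e′ ≤ m → act e ≡ true → act e′ ≡ true → ¬ Balanced e → ¬ Balanced e′ → e ≡ e′

  Backward : ℕ → Set
  Backward e = act e ≡ true × is-nothing (asg e) ≡ true × is-nothing (asg (next m e)) ≡ false

  backward? : ∀ e → Dec (Backward e)
  backward? e = (act e ≟ᴮ true) ×-dec (is-nothing (asg e) ≟ᴮ true) ×-dec (is-nothing (asg (next m e)) ≟ᴮ false)

  backward-unbalanced : ∀ {e} → Backward e → ¬ Balanced e
  backward-unbalanced (_ , ue , un) bal with trans (sym ue) (trans bal un)
  ... | ()

  balanced-forward : ∀ {e} → Balanced e → asg e ≡ nothing → asg (next m e) ≡ nothing
  balanced-forward {e} bal ue with asg (next m e) | bal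
  ... | nothing | _ = refl
  ... | just _  | bal′ rewrite ue with bal′
  ...   | ()

  -- Propagate values around the cycle starting from vertex 0; the
  -- argument y is the value entering vertex 0 along edge m.
  sweep : Bool → ℕ → Bool
  sweep y zero    = fromMaybe (act m ∧ (y xor w m)) (asg zero)
  sweep y (suc v) = fromMaybe (act v ∧ (sweep y v xor w v)) (asg (suc v))

  sweep-respects : ∀ y → Respects (sweep y)
  sweep-respects y zero    b eq rewrite eq = refl
  sweep-respects y (suc v) b eq rewrite eq = refl

  sweep-cut : ∀ {c} → act c ≡ false → ∀ {v} → c < v → ∀ y y′ → sweep y v ≡ sweep y′ v
  sweep-cut {c} off {suc v} c<1+v y y′ with m<1+n⇒m<n∨m≡n c<1+v
  ... | inj₂ refl rewrite off = refl
  ... | inj₁ c<v = cong (λ z → fromMaybe (act v ∧ (z xor w v)) (asg (suc v))) (sweep-cut off c<v y y′)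

  flip : Bool → (ℕ → Bool) → ℕ → Bool
  flip g X v = X v xor (g ∧ is-nothing (asg v))

  flip-respects : ∀ {X} g → Respects X → Respects (flip g X)
  flip-respects {X} g r v b eq rewrite r v b eq | eq | ∧-zeroʳ g = xor-identityʳ b

  flip-edge : ∀ {X e} g → XorEdge m w X e → Balanced e → XorEdge m w (flip g X) e
  flip-edge {X} {e} g edge bal rewrite edge | bal = xor-swap (X e) (w e) (g ∧ is-nothing (asg (next m e)))

  flip-pin : ∀ X {v} b → asg v ≡ nothing → flip (X v xor b) X v ≡ b
  flip-pin X {v} b eq rewrite eq | ∧-identityʳ (X v xor b) = xor-cancelˡ (X v) b

  module _ (e₀ : ℕ) (e₀≤m : e₀ ≤ m) (e₀-inactive : act e₀ ≡ false)
           (consistent : ∀ e → e ≤ m → act e ≡ true → ConsistentEdge e) where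

    -- Feeding the sweep its own value at m closes the cycle.
    X : ℕ → Bool
    X = sweep (sweep false m)

    X-next : ∀ e → e ≤ m → act e ≡ true → X (next m e) ≡ fromMaybe (act e ∧ (X e xor w e)) (asg (next m e))
    X-next e e≤m on with m≤n⇒m<n∨m≡n e≤m
    ... | inj₁ e<m rewrite next-< e<m = refl
    ... | inj₂ refl rewrite next-last e =
      cong (λ z → fromMaybe (act e ∧ (z xor w e)) (asg 0)) (sweep-cut e₀-inactive e₀<m false (sweep false e))
      where
      e₀<m : e₀ < e
      e₀<m = ≤∧≢⇒< e₀≤m λ { refl → contradiction (trans (sym e₀-inactive) on) λ () }

    X-edge : ∀ e → e ≤ m → act e ≡ true → (asg e ≡ nothing → asg (next m e) ≡ nothing) → XorEdge m w X e
    X-edge e e≤m on forward = trans (X-next e e≤m on) (settle (asg (next m e)) on head-value)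
      where
      settle : ∀ {a z} (o : Maybe Bool) → a ≡ true → (∀ b → o ≡ just b → b ≡ z) → fromMaybe (a ∧ z) o ≡ z
      settle (just b) _ h = h b refl
      settle nothing refl _ = refl
      head-value : ∀ b′ → asg (next m e) ≡ just b′ → b′ ≡ X e xor w e
      head-value b′ un with asg e in ue
      ... | just b rewrite sweep-respects (sweep false m) e b ue = consistent e e≤m on b b′ ue un
      ... | nothing with trans (sym un) (forward refl)
      ...   | ()

    X-balanced-edge : ∀ {e} → e ≤ m → act e ≡ true → Balanced e → XorEdge m w X e
    X-balanced-edge {e} e≤m on bal = X-edge e e≤m on (balanced-forward bal)

    solve : AtMostOneUnbalanced → Σ (ℕ → Bool) Solves
    solve unique with anyUpTo? backward? (suc m)
    ... | no none = X , sweep-respects _ , λ e e≤m on → X-edge e e≤m on (forward e e≤m on)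
      where
      forward : ∀ e → e ≤ m → act e ≡ true → asg e ≡ nothing → asg (next m e) ≡ nothing
      forward e e≤m on ue with asg (next m e) in un
      ... | nothing = refl
      ... | just b  = ⊥-elim (none (e , s≤s e≤m , on , cong is-nothing ue , cong is-nothing un))
    ... | yes (j , s≤s j≤m , bwd@(onj , uj , unj)) = flip g X , flip-respects g (sweep-respects _) , edge
      where
      b = proj₁ (is-nothing-false unj)
      asg-next-j : asg (next m j) ≡ just b
      asg-next-j = proj₂ (is-nothing-false unj)
      x′ = X (next m j) xor w j
      g = X j xor x′
      edge : ∀ e → e ≤ m → act e ≡ true → XorEdge m w (flip g X) e
      edge e e≤m on with is-nothing (asg e) ≟ᴮ is-nothing (asg (next m e))
      ... | yes bal = flip-edge {X} g (X-balanced-edge e≤m on bal) bal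
      ... | no unbal rewrite unique e j e≤m j≤m on onj unbal (backward-unbalanced bwd) = begin
        flip g X (next m j)   ≡⟨ flip-respects g (sweep-respects _) (next m j) b asg-next-j ⟩
        b                     ≡⟨ sym (sweep-respects _ (next m j) b asg-next-j) ⟩
        X (next m j)          ≡⟨ sym (xor-cancelʳ (X (next m j)) (w j)) ⟩
        x′ xor w j            ≡⟨ cong (_xor w j) (sym (flip-pin X x′ (is-nothing-true uj))) ⟩
        flip g X j xor w j    ∎
        where open ≡-Reasoning

    solve-pinned : AllBalanced → ∀ v b → asg v ≡ nothing → Σ (ℕ → Bool) λ Y → Solves Y × Y v ≡ b
    solve-pinned balanced v b uv = flip g X , (flip-respects g (sweep-respects _) , edge) , flip-pin X b uv
      where
      g = X v xor b
      edge : ∀ e → e ≤ m → act e ≡ true → XorEdge m w (flip g X) e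
      edge e e≤m on = flip-edge {X} g (X-balanced-edge e≤m on (balanced e e≤m on)) (balanced e e≤m on)

-- The encoding

exclusion-sat : ∀ σ c g → (σ c ≡ true → σ g ≡ false) → SatClause σ (neg c ∷ neg g ∷ [])
exclusion-sat σ c g h = sat (σ c) refl
  where
  sat : ∀ x → σ c ≡ x → SatClause σ (neg c ∷ neg g ∷ [])
  sat false ec = here (cong not ec)
  sat true  ec = there (here (cong not (h ec)))

sat-⊆ : ∀ {σ φ φ′} → Sat σ φ → (∀ {C} → C ∈ φ′ → C ∈ φ) → Sat σ φ′
sat-⊆ s sub = All.tabulate λ C∈ → All.lookup s (sub C∈)

length-concatMap : ∀ {A B : Set} (f : A → List B) k → (∀ x → length (f x) ≡ k) →
                   ∀ xs → length (concatMap f xs) ≡ length xs * k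
length-concatMap f k len []       = refl
length-concatMap f k len (x ∷ xs) = trans (length-++ (f x)) (cong₂ _+_ (len x) (length-concatMap f k len xs))

extendAbove : ℕ → Assignment → (ℕ → Bool) → Assignment
extendAbove k σ f v with v <? k
... | yes _ = σ v
... | no _  = f (v ∸ k)

extendAbove-below : ∀ {k σ f v} → v < k → extendAbove k σ f v ≡ σ v
extendAbove-below {k} {v = v} v<k with v <? k
... | yes _   = refl
... | no v≮k = contradiction v<k v≮k

extendAbove-above : ∀ k σ f i → extendAbove k σ f (k + i) ≡ f i
extendAbove-above k σ f i with k + i <? k
... | yes k+i<k = contradiction (≤-trans (m≤m+n (suc k) i) k+i<k) (<-irrefl refl)
... | no _      = cong f (m+n∸m≡n k i)

closing : ℕ → ℕ → Bool
closing m e = does (e ≟ m)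

closing-< : ∀ {m e} → e < m → closing m e ≡ false
closing-< {m} {e} e<m = dec-false (e ≟ m) (λ e≡m → <-irrefl e≡m e<m)

closing-last : ∀ m → closing m m ≡ true
closing-last m = dec-true (m ≟ m) refl

edge-chain : ∀ {m X e} → e < m → X e ≡ X (suc e) → XorEdge m (closing m) X e
edge-chain {m} {X} {e} e<m eq rewrite next-< e<m | closing-< e<m =
  trans (sym eq) (sym (xor-identityʳ (X e)))

edge-chain⁻ : ∀ {m X e} → e < m → XorEdge m (closing m) X e → X e ≡ X (suc e)
edge-chain⁻ {m} {X} {e} e<m edge rewrite next-< e<m | closing-< e<m =
  trans (sym (xor-identityʳ (X e))) (sym edge)

edge-last : ∀ {m X} → X 0 ≡ not (X m) → XorEdge m (closing m) X m
edge-last {m} {X} eq rewrite next-last m | closing-last m = trans eq (sym (xor-true (X m)))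

edge-last⁻ : ∀ {m X} → XorEdge m (closing m) X m → X 0 ≡ not (X m)
edge-last⁻ {m} {X} edge rewrite next-last m | closing-last m = trans edge (xor-true (X m))

data Label : Set where
  labelA labelB : Label

module Encoding (m : ℕ) where

  n : ℕ
  n = suc m

  labelVar : Label → ℕ → ℕ
  labelVar labelA = av n
  labelVar labelB = bv n

  -- c_i asserts that edge i is switched off.
  cv : ℕ → ℕ
  cv i = n + (n + n) + i

  offClause : Clause
  offClause = map (λ i → pos (cv i)) (upTo n)

  offImplications : ℕ → List Clause
  offImplications i = (neg (cv i) ∷ neg (av n i) ∷ []) ∷ (neg (cv i) ∷ neg (bv n i) ∷ []) ∷ []

  ψ : CNF
  ψ = psi n ++ offClause ∷ concatMap offImplications (upTo n)

  active : Assignment → ℕ → Bool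
  active σ e = σ (av n e) ∨ σ (bv n e)

  active-label : ∀ σ s {e} → σ (labelVar s e) ≡ true → active σ e ≡ true
  active-label σ labelA {e} on rewrite on = refl
  active-label σ labelB {e} on rewrite on = ∨-zeroʳ (σ (av n e))

  inactive-label : ∀ σ s {e} → active σ e ≡ false → σ (labelVar s e) ≡ false
  inactive-label σ s {e} off with σ (labelVar s e) in on
  ... | false = refl
  ... | true  = trans (sym (active-label σ s on)) off

  some-label : ∀ σ {e} → active σ e ≡ true → Σ Label λ s → σ (labelVar s e) ≡ true
  some-label σ {e} on with σ (av n e) in ea
  ... | true  = labelA , ea
  ... | false = labelB , on

  CycleHolds : Assignment → Set
  CycleHolds σ = ∀ e → e ≤ m → active σ e ≡ true → XorEdge m (closing m) σ e

  chainGadget : Label → ℕ → List Clause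
  chainGadget s i = equivalence (labelVar s i) i (pos (suc i))

  lastGadget : Label → List Clause
  lastGadget s = equivalence (labelVar s m) 0 (neg m)

  ∈-chainGadget : ∀ s {i C} → i < m → C ∈ chainGadget s i → C ∈ psi n
  ∈-chainGadget s {i} i<m C∈ = ∈-++⁺ˡ (∈-concatMap⁺ (chainClauses n) (lose (∈-upTo⁺ i<m) (chain s C∈)))
    where
    chain : ∀ s {C} → C ∈ chainGadget s i → C ∈ chainClauses n i
    chain labelA C∈ = ∈-++⁺ˡ C∈
    chain labelB C∈ = ∈-++⁺ʳ (chainGadget labelA i) C∈

  ∈-lastGadget : ∀ s {C} → C ∈ lastGadget s → C ∈ psi n
  ∈-lastGadget s C∈ = ∈-++⁺ʳ (concatMap (chainClauses n) (upTo m)) (last s C∈)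
    where
    last : ∀ s {C} → C ∈ lastGadget s → C ∈ lastClauses n
    last labelA C∈ = ∈-++⁺ˡ C∈
    last labelB C∈ = ∈-++⁺ʳ (lastGadget labelA) C∈

  ∈-ψ : ∀ {C} → C ∈ psi n → C ∈ ψ
  ∈-ψ = ∈-++⁺ˡ

  sat-psi⁺ : ∀ σ → CycleHolds σ → Sat σ (psi n)
  sat-psi⁺ σ h = ++⁺ (concat⁺ (map⁺ (applyUpTo⁺₁ id m chain))) (++⁺ (last-gadget labelA) (last-gadget labelB))
    where
    chain-gadget : ∀ {i} → i < m → ∀ s → Sat σ (chainGadget s i)
    chain-gadget {i} i<m s = equivalence-sat σ (labelVar s i) i (pos (suc i))
      λ on → edge-chain⁻ {X = σ} i<m (h i (<⇒≤ i<m) (active-label σ s on))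
    chain : ∀ {i} → i < m → Sat σ (chainClauses n i)
    chain i<m = ++⁺ (chain-gadget i<m labelA) (chain-gadget i<m labelB)
    last-gadget : ∀ s → Sat σ (lastGadget s)
    last-gadget s = equivalence-sat σ (labelVar s m) 0 (neg m)
      λ on → edge-last⁻ {X = σ} (h m ≤-refl (active-label σ s on))

  sat-psi⁻ : ∀ σ → Sat σ (psi n) → CycleHolds σ
  sat-psi⁻ σ S e e≤m on with some-label σ on | m≤n⇒m<n∨m≡n e≤m
  ... | s , on′ | inj₁ e<m  = edge-chain {X = σ} e<m (equivalence-sound σ (sat-⊆ S (∈-chainGadget s e<m)) on′)
  ... | s , on′ | inj₂ refl = edge-last {X = σ} (equivalence-sound σ (sat-⊆ S (∈-lastGadget s)) on′)

  -- Going once around the cycle flips the value, so not every edge can be active.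
  some-inactive : ∀ σ → CycleHolds σ → Σ ℕ λ e → e ≤ m × active σ e ≡ false
  some-inactive σ h with anyUpTo? (λ e → active σ e ≟ᴮ false) (suc m)
  ... | yes (e , s≤s e≤m , off) = e , e≤m , off
  ... | no none = ⊥-elim (not-¬ (sym (same m ≤-refl)) (edge-last⁻ {X = σ} (h m ≤-refl (on m ≤-refl))))
    where
    on : ∀ e → e ≤ m → active σ e ≡ true
    on e e≤m = ¬-not λ off → none (e , s≤s e≤m , off)
    same : ∀ e → e ≤ m → σ e ≡ σ 0
    same zero    _     = refl
    same (suc e) e<m = trans (sym (edge-chain⁻ {X = σ} e<m (h e (<⇒≤ e<m) (on e (<⇒≤ e<m))))) (same e (<⇒≤ e<m))

  x<bound : ∀ {i} → i ≤ m → i < n + (n + n)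
  x<bound i≤m = ≤-trans (s≤s i≤m) (m≤m+n n (n + n))

  label<bound : ∀ s {i} → i ≤ m → labelVar s i < n + (n + n)
  label<bound labelA i≤m = +-monoʳ-< n (≤-trans (s≤s i≤m) (m≤m+n n n))
  label<bound labelB {i} i≤m = subst (n + n + i <_) (+-comm (n + n) n) (+-monoʳ-< (n + n) (s≤s i≤m))

  agree-cycle : ∀ {σ τ} → (∀ v → v < n + (n + n) → σ v ≡ τ v) → CycleHolds σ → CycleHolds τ
  agree-cycle {σ} {τ} agree h e e≤m on = begin
    τ (next m e)          ≡⟨ sym (agree _ (x<bound (next-≤ e≤m))) ⟩
    σ (next m e)          ≡⟨ h e e≤m on′ ⟩
    σ e xor closing m e   ≡⟨ cong (_xor closing m e) (agree e (x<bound e≤m)) ⟩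
    τ e xor closing m e   ∎
    where
    open ≡-Reasoning
    on′ : active σ e ≡ true
    on′ = trans (cong₂ _∨_ (agree _ (label<bound labelA e≤m)) (agree _ (label<bound labelB e≤m))) on

  encoding : IsEncoding (3 * n) (psi n) ψ
  encoding σ = mk⇔ to from
    where
    3n≡ : 3 * n ≡ n + (n + n)
    3n≡ = cong (λ k → n + (n + k)) (+-identityʳ n)
    to : Sat σ (psi n) → Σ Assignment λ τ → (∀ v → v < 3 * n → τ v ≡ σ v) × Sat τ ψ
    to S = τ , (λ v v< → extendAbove-below (subst (v <_) 3n≡ v<)) ,
           ++⁺ (sat-psi⁺ τ (agree-cycle (λ v v< → sym (extendAbove-below v<)) (sat-psi⁻ σ S))) (off ∷ implications)
      where
      τ : Assignment
      τ = extendAbove (n + (n + n)) σ (λ i → not (active σ i))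
      τ-cv : ∀ i → τ (cv i) ≡ not (active σ i)
      τ-cv i = extendAbove-above (n + (n + n)) σ _ i
      off : SatClause τ offClause
      off with some-inactive σ (sat-psi⁻ σ S)
      ... | e₀ , e₀≤m , e₀-off =
        lose (∈-map⁺ (λ i → pos (cv i)) (∈-upTo⁺ (s≤s e₀≤m))) (trans (τ-cv e₀) (cong not e₀-off))
      exclusion : ∀ {i} → i < n → ∀ s → SatClause τ (neg (cv i) ∷ neg (labelVar s i) ∷ [])
      exclusion {i} (s≤s i≤m) s = exclusion-sat τ (cv i) (labelVar s i) λ c-on →
        trans (extendAbove-below (label<bound s i≤m))
          (inactive-label σ s (not-injective (trans (sym (τ-cv i)) c-on)))
      implications : Sat τ (concatMap offImplications (upTo n))
      implications = concat⁺ (map⁺ (applyUpTo⁺₁ id n λ i<n → exclusion i<n labelA ∷ exclusion i<n labelB ∷ []))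
    from : Σ Assignment (λ τ → (∀ v → v < 3 * n → τ v ≡ σ v) × Sat τ ψ) → Sat σ (psi n)
    from (τ , agree , S) =
      sat-psi⁺ σ (agree-cycle (λ v v< → agree v (subst (v <_) (sym 3n≡) v<)) (sat-psi⁻ τ (++⁻ˡ (psi n) S)))

  length-ψ : length ψ ≡ (m * 4 + 4) + suc (n * 2)
  length-ψ = trans (length-++ (psi n)) (cong₂ (λ x y → x + suc y) length-psi length-implications)
    where
    length-psi : length (psi n) ≡ m * 4 + 4
    length-psi = trans (length-++ (concatMap (chainClauses n) (upTo m)))
      (cong (_+ 4) (trans (length-concatMap (chainClauses n) 4 (λ _ → refl) (upTo m))
                          (cong (_* 4) (length-upTo m))))
    length-implications : length (concatMap offImplications (upTo n)) ≡ n * 2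
    length-implications =
      trans (length-concatMap offImplications 2 (λ _ → refl) (upTo n)) (cong (_* 2) (length-upTo n))

  size : length ψ ≤ 3 * (3 * n)
  size = begin
    length ψ                                           ≡⟨ length-ψ ⟩
    (m * 4 + 4) + suc (n * 2)                          ≤⟨ m≤m+n _ (m * 3 + 2) ⟩
    (m * 4 + 4) + suc (n * 2) + (m * 3 + 2)            ≡⟨ sym (slack m) ⟩
    3 * (3 * n)                                        ∎
    where
    open ≤-Reasoning
    slack : ∀ m → 3 * (3 * suc m) ≡ (m * 4 + 4) + suc (suc m * 2) + (m * 3 + 2)
    slack = solve-∀

  ∈-offClause : ∀ {i} → i ≤ m → pos (cv i) ∈ offClause
  ∈-offClause i≤m = ∈-map⁺ (λ i → pos (cv i)) (∈-upTo⁺ (s≤s i≤m))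

  offClause-∈ : ∀ {l} → l ∈ offClause → Σ ℕ λ i → i ≤ m × l ≡ pos (cv i)
  offClause-∈ l∈ with ∈-map⁻ (λ i → pos (cv i)) l∈
  ... | i , i∈ , refl with ∈-upTo⁻ i∈
  ...   | s≤s i≤m = i , i≤m , refl

  offClause∈ψ : offClause ∈ ψ
  offClause∈ψ = ∈-++⁺ʳ (psi n) (here refl)

  ∈-offImplications : ∀ s {i} → i ≤ m → (neg (cv i) ∷ neg (labelVar s i) ∷ []) ∈ ψ
  ∈-offImplications s i≤m =
    ∈-++⁺ʳ (psi n) (there (∈-concatMap⁺ offImplications (lose (∈-upTo⁺ (s≤s i≤m)) (implication s))))
    where
    implication : ∀ s {i} → (neg (cv i) ∷ neg (labelVar s i) ∷ []) ∈ offImplications i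
    implication labelA = here refl
    implication labelB = there (here refl)

  av<bv : ∀ {i j} → i ≤ m → av n i < bv n j
  av<bv {j = j} i≤m = <-≤-trans (+-monoʳ-< n (s≤s i≤m)) (m≤m+n (n + n) j)

  labelVar-injective : ∀ s s′ {i j} → i ≤ m → j ≤ m → labelVar s i ≡ labelVar s′ j → i ≡ j
  labelVar-injective labelA labelA _   _   eq = +-cancelˡ-≡ n _ _ eq
  labelVar-injective labelB labelB _   _   eq = +-cancelˡ-≡ (n + n) _ _ eq
  labelVar-injective labelA labelB i≤m _   eq = ⊥-elim (<-irrefl eq (av<bv i≤m))
  labelVar-injective labelB labelA _   j≤m eq = ⊥-elim (<-irrefl (sym eq) (av<bv j≤m))

  labelVar-≥ : ∀ s i → n ≤ labelVar s i
  labelVar-≥ labelA i = m≤m+n n i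
  labelVar-≥ labelB i = ≤-trans (m≤m+n n n) (m≤m+n (n + n) i)

  cv-injective : ∀ {i j} → cv i ≡ cv j → i ≡ j
  cv-injective = +-cancelˡ-≡ (n + (n + n)) _ _

  Touches : Maybe Lit → ℕ → Set
  Touches t j = (Σ Label λ s → t ≡ just (pos (labelVar s j))) ⊎ t ≡ just (neg (cv j))

  touches? : ∀ t j → Dec (Touches t j)
  touches? nothing j = no λ { (inj₁ (_ , ())) ; (inj₂ ()) }
  touches? (just l) j with l ≟L pos (labelVar labelA j) | l ≟L pos (labelVar labelB j) | l ≟L neg (cv j)
  ... | yes refl | _        | _        = yes (inj₁ (labelA , refl))
  ... | no _     | yes refl | _        = yes (inj₁ (labelB , refl))
  ... | no _     | no _     | yes refl = yes (inj₂ refl)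
  ... | no ¬a    | no ¬b    | no ¬c    =
    no λ { (inj₁ (labelA , refl)) → ¬a refl ; (inj₁ (labelB , refl)) → ¬b refl ; (inj₂ refl) → ¬c refl }

  touches-unique : ∀ {t i j} → i ≤ m → j ≤ m → Touches t i → Touches t j → i ≡ j
  touches-unique i≤m j≤m (inj₁ (s , refl)) (inj₁ (s′ , eq)) =
    labelVar-injective s s′ i≤m j≤m (cong var (just-injective eq))
  touches-unique i≤m j≤m (inj₂ refl) (inj₂ eq) = cv-injective (cong var (just-injective eq))
  touches-unique i≤m j≤m (inj₁ (_ , refl)) (inj₂ ())
  touches-unique i≤m j≤m (inj₂ refl) (inj₁ (_ , ()))

  OnX : Maybe Lit → Set
  OnX t = Σ Lit λ l → t ≡ just l × var l < n

  onX? : ∀ t → Dec (OnX t)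
  onX? nothing  = no λ { (_ , () , _) }
  onX? (just l) with var l <? n
  ... | yes l<n = yes (l , refl , l<n)
  ... | no l≮n  = no λ { (_ , refl , l<n) → l≮n l<n }

  -- A model of ψ ∧ α ∧ t, for α unit-closed and t fresh.
  module Model (α : List Lit) (cons : Consistent α) (closed : UnitClosed ψ α)
               (t : Maybe Lit) (fresh : Fresh α t) where

    asg : ℕ → Maybe Bool
    asg = valuation α

    β : ℕ → Maybe Bool
    β = extendedValuation cons fresh

    label : Label → ℕ → Bool
    label s e = fromMaybe false (β (labelVar s e))

    act : ℕ → Bool
    act e = label labelA e ∨ label labelB e

    label-holds : ∀ s {e} → label s e ≡ true → Holds α t (pos (labelVar s e))
    label-holds s {e} on with β (labelVar s e) in eq
    label-holds s refl | just true  = extendedValuation-holds cons fresh eq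
    label-holds s ()   | just false
    label-holds s ()   | nothing

    some-label-holds : ∀ {e} → act e ≡ true → Σ Label λ s → Holds α t (pos (labelVar s e))
    some-label-holds {e} on with label labelA e in ea
    ... | true  = labelA , label-holds labelA ea
    ... | false = labelB , label-holds labelB on

    act-off : ∀ {e} → (∀ s → ¬ Holds α t (pos (labelVar s e))) → act e ≡ false
    act-off {e} none with act e in on
    ... | false = refl
    ... | true  = let s , g-holds = some-label-holds on in ⊥-elim (none s g-holds)

    switchedOff : ℕ → Bool
    switchedOff j = fromMaybe (not (act j)) (β (cv j))

    switchedOff-inactive : ∀ {j} → j ≤ m → switchedOff j ≡ true → act j ≡ false
    switchedOff-inactive {j} j≤m off with β (cv j) in eq
    ... | nothing = not-injective off
    ... | just true = act-off λ s g-holds →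
          extension-refutes-no-clause closed cons fresh (∈-offImplications s j≤m) (here refl)
            (extendedValuation-holds cons fresh eq ∷ g-holds ∷ [])
    switchedOff-inactive {j} j≤m () | just false

    untouched-switchedOff : ∀ {j} → j ≤ m → neg (cv j) ∉ α → ¬ Touches t j → switchedOff j ≡ true
    untouched-switchedOff {j} j≤m ¬c∉α untouched with β (cv j) in eq
    ... | just true = refl
    ... | just false with extendedValuation-holds cons fresh eq
    ...   | inj₁ ¬c∈α = contradiction ¬c∈α ¬c∉α
    ...   | inj₂ t≡¬c = contradiction (inj₂ t≡¬c) untouched
    untouched-switchedOff {j} j≤m ¬c∉α untouched | nothing = cong not (act-off label-off)
      where
      label-off : ∀ s → ¬ Holds α t (pos (labelVar s j))
      label-off s (inj₂ t≡g) = untouched (inj₁ (s , t≡g))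
      label-off s (inj₁ g∈α) =
        ¬c∉α (closed (∈-offImplications s j≤m) (here refl) (inj₁ refl ∷ inj₂ g∈α ∷ []))

    -- Unless α sets some c_j, the clause ⋁ c_j has two free literals and t touches at most one.
    some-switchedOff : Σ ℕ λ j → j ≤ m × switchedOff j ≡ true
    some-switchedOff with satisfied-or-two-free closed offClause∈ψ (∈-offClause z≤n)
    ... | inj₁ sat with find sat
    ...   | l , l∈ , l∈α with offClause-∈ l∈
    ...     | j , j≤m , refl =
      j , j≤m , cong (fromMaybe (not (act j))) (holds-extendedValuation cons fresh (inj₁ l∈α))
    some-switchedOff | inj₂ (l , l′ , l∈ , l′∈ , l≢l′ , ¬l∉α , ¬l′∉α)
      with offClause-∈ l∈ | offClause-∈ l′∈
    ... | j , j≤m , refl | j′ , j′≤m , refl with touches? t j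
    ...   | no untouched = j , j≤m , untouched-switchedOff j≤m ¬l∉α untouched
    ...   | yes touched = j′ , j′≤m , untouched-switchedOff j′≤m ¬l′∉α λ touched′ →
            l≢l′ (cong (λ i → pos (cv i)) (touches-unique j≤m j′≤m touched touched′))

    e₀ : ℕ
    e₀ = proj₁ some-switchedOff

    e₀≤m : e₀ ≤ m
    e₀≤m = proj₁ (proj₂ some-switchedOff)

    e₀-inactive : act e₀ ≡ false
    e₀-inactive = switchedOff-inactive e₀≤m (proj₂ (proj₂ some-switchedOff))

    open XorCycle m (closing m) act asg

    gadget-consistent : ∀ {e} → e ≤ m → ∀ s → Holds α t (pos (labelVar s e)) → ConsistentEdge e
    gadget-consistent {e} e≤m s g-holds b b′ eu el with m≤n⇒m<n∨m≡n e≤m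
    ... | inj₁ e<m rewrite closing-< e<m | xor-identityʳ b =
      sym (equivalence-consistent cons closed (∈-ψ ∘ ∈-chainGadget s e<m) fresh g-holds eu
             (trans (cong asg (sym (next-< e<m))) el))
    ... | inj₂ refl rewrite closing-last e | xor-true b =
      equivalence-consistent cons closed (∈-ψ ∘ ∈-lastGadget s) fresh g-holds
        (trans (cong asg (sym (next-last e))) el) eu

    gadget-balanced : ∀ {e} → e ≤ m → ∀ s → pos (labelVar s e) ∈ α → Balanced e
    gadget-balanced {e} e≤m s g∈α with m≤n⇒m<n∨m≡n e≤m
    ... | inj₁ e<m rewrite next-< e<m = equivalence-balanced cons closed (∈-ψ ∘ ∈-chainGadget s e<m) g∈α
    ... | inj₂ refl rewrite next-last e = sym (equivalence-balanced cons closed (∈-ψ ∘ ∈-lastGadget s) g∈α)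

    consistent : ∀ e → e ≤ m → act e ≡ true → ConsistentEdge e
    consistent e e≤m on = let s , g-holds = some-label-holds on in gadget-consistent e≤m s g-holds

    unbalanced-touched : ∀ {e} → e ≤ m → act e ≡ true → ¬ Balanced e →
                         Σ Label λ s → t ≡ just (pos (labelVar s e))
    unbalanced-touched e≤m on unbal with some-label-holds on
    ... | s , inj₁ g∈α = ⊥-elim (unbal (gadget-balanced e≤m s g∈α))
    ... | s , inj₂ t≡g = s , t≡g

    XSpec : (ℕ → Bool) → Set
    XSpec Y = Solves Y × (∀ l → t ≡ just l → var l < n → Y (var l) ≡ sign l)

    x-values : Σ (ℕ → Bool) XSpec
    x-values with onX? t
    ... | yes (l , t≡l , l<n) with solve-pinned e₀ e₀≤m e₀-inactive consistent balanced (var l) (sign l)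
                                      (valuation-unassigned (fresh l t≡l))
      where
      balanced : AllBalanced
      balanced e e≤m on with is-nothing (asg e) ≟ᴮ is-nothing (asg (next m e))
      ... | yes bal = bal
      ... | no unbal with unbalanced-touched e≤m on unbal
      ...   | s , t≡g with trans (sym t≡l) t≡g
      ...     | refl = ⊥-elim (<-irrefl refl (<-≤-trans l<n (labelVar-≥ s e)))
    ...   | Y , solves , pinned = Y , solves , λ l′ t≡l′ _ →
                                  subst (λ k → Y (var k) ≡ sign k) (just-injective (trans (sym t≡l) t≡l′)) pinned
    x-values | no ¬onX = Y , solves , λ l t≡l l<n → ⊥-elim (¬onX (l , t≡l , l<n))
      where
      unique : AtMostOneUnbalanced
      unique e e′ e≤m e′≤m on on′ unbal unbal′ =
        touches-unique e≤m e′≤m (inj₁ (unbalanced-touched e≤m on unbal))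
                                (inj₁ (unbalanced-touched e′≤m on′ unbal′))
      Y = proj₁ (solve e₀ e₀≤m e₀-inactive consistent unique)
      solves = proj₂ (solve e₀ e₀≤m e₀-inactive consistent unique)

    Xf : ℕ → Bool
    Xf = proj₁ x-values

    Xf-respects : Respects Xf
    Xf-respects = proj₁ (proj₁ (proj₂ x-values))

    Xf-edge : ∀ e → e ≤ m → act e ≡ true → XorEdge m (closing m) Xf e
    Xf-edge = proj₂ (proj₁ (proj₂ x-values))

    Xf-target : ∀ l → t ≡ just l → var l < n → Xf (var l) ≡ sign l
    Xf-target = proj₂ (proj₂ x-values)

    x-value : ∀ {i} b → i ≤ m → Holds α t (lit i b) → Xf i ≡ b
    x-value {i} b i≤m (inj₁ l∈α) = Xf-respects i b (valuation-lit cons b l∈α)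
    x-value {i} b i≤m (inj₂ t≡l) =
      subst₂ (λ v c → Xf v ≡ c) (lit-var i b) (lit-sign i b)
        (Xf-target (lit i b) t≡l (subst (_< n) (sym (lit-var i b)) (s≤s i≤m)))

    default : ℕ → Bool
    default = extendAbove n Xf (extendAbove (n + n) (λ _ → false) (λ i → not (act i)))

    σ : Assignment
    σ v = fromMaybe (default v) (β v)

    default-label : ∀ s {i} → i ≤ m → default (labelVar s i) ≡ false
    default-label labelA {i} i≤m =
      trans (extendAbove-above n Xf _ i) (extendAbove-below (≤-trans (s≤s i≤m) (m≤m+n n n)))
    default-label labelB {i} i≤m =
      trans (cong default (+-assoc n n i))
        (trans (extendAbove-above n Xf _ (n + i)) (extendAbove-below (+-monoʳ-< n (s≤s i≤m))))

    σ-holds : ∀ {l} → Holds α t l → evalLit σ l ≡ true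
    σ-holds {l} h = evalLit-sign σ l (cong (fromMaybe (default (var l))) (holds-extendedValuation cons fresh h))

    σ-x : ∀ {i} → i ≤ m → σ i ≡ Xf i
    σ-x {i} i≤m with β i in eq
    ... | nothing = extendAbove-below (s≤s i≤m)
    ... | just b  = sym (x-value b i≤m (extendedValuation-holds cons fresh eq))

    σ-label : ∀ s {i} → i ≤ m → σ (labelVar s i) ≡ label s i
    σ-label s {i} i≤m = cong (λ d → fromMaybe d (β (labelVar s i))) (default-label s i≤m)

    σ-cv : ∀ j → σ (cv j) ≡ switchedOff j
    σ-cv j = cong (λ d → fromMaybe d (β (cv j)))
      (trans (cong default (+-assoc n (n + n) j))
        (trans (extendAbove-above n Xf _ _) (extendAbove-above (n + n) _ _ j)))

    label-off : ∀ s {e} → act e ≡ false → label s e ≡ false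
    label-off labelA {e} off = ∨-conicalˡ (label labelA e) (label labelB e) off
    label-off labelB {e} off = ∨-conicalʳ (label labelA e) (label labelB e) off

    cycle : CycleHolds σ
    cycle e e≤m on = begin
      σ (next m e)            ≡⟨ σ-x (next-≤ e≤m) ⟩
      Xf (next m e)           ≡⟨ Xf-edge e e≤m (trans (sym σ-active) on) ⟩
      Xf e xor closing m e    ≡⟨ cong (_xor closing m e) (sym (σ-x e≤m)) ⟩
      σ e xor closing m e     ∎
      where
      open ≡-Reasoning
      σ-active : active σ e ≡ act e
      σ-active = cong₂ _∨_ (σ-label labelA e≤m) (σ-label labelB e≤m)

    sat : Sat σ ψ
    sat = ++⁺ (sat-psi⁺ σ cycle) (off ∷ implications)
      where
      off : SatClause σ offClause
      off = lose (∈-offClause e₀≤m) (trans (σ-cv e₀) (proj₂ (proj₂ some-switchedOff)))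
      exclusion : ∀ {i} → i < n → ∀ s → SatClause σ (neg (cv i) ∷ neg (labelVar s i) ∷ [])
      exclusion {i} (s≤s i≤m) s = exclusion-sat σ (cv i) (labelVar s i) λ c-on →
        trans (σ-label s i≤m) (label-off s (switchedOff-inactive i≤m (trans (sym (σ-cv i)) c-on)))
      implications : Sat σ (concatMap offImplications (upTo n))
      implications = concat⁺ (map⁺ (applyUpTo⁺₁ id n λ i<n → exclusion i<n labelA ∷ exclusion i<n labelB ∷ []))

    sat-α : All (λ l → evalLit σ l ≡ true) α
    sat-α = All.tabulate (σ-holds ∘ inj₁)

  ψ-closure-complete : UnitClosureComplete ψ
  ψ-closure-complete α cons closed l l∉α entails with negate l ∈? α
  ... | yes ¬l∈α = evalLit-contradiction σ l (entails σ sat sat-α) (All.lookup sat-α ¬l∈α)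
    where
    open Model α cons closed nothing (λ _ ())
  ... | no ¬l∉α = evalLit-contradiction σ l (entails σ sat sat-α) (σ-holds (inj₂ refl))
    where
    fresh : Fresh α (just (negate l))
    fresh _ refl = subst (Unassigned α) (sym (var-negate l)) (unassigned-var l l∉α ¬l∉α)
    open Model α cons closed (just (negate l)) fresh

lemma3 : Σ ℕ (λ c → ∀ (n : ℕ) → 1 ≤ n →
           Σ CNF (λ ψ → IsEncoding (3 * n) (psi n) ψ × PC ψ × length ψ ≤ c * (3 * n)))
lemma3 = 3 , λ { zero () ; (suc m) _ → ψ m , encoding m , pc-from-closure (ψ-closure-complete m) , size m }
  where
  open Encoding
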